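{- In the table with $5$ rows, for all $s\ge1$: \[\mathcal{D}(s+2,1)=\mathcal{I}_5(s)\quad\text{and}\quad \mathcal{D}(s+2,3)=2\,\mathcal{I}_5(s)-1.\]
   Context: For $m\ge1$ and $s\ge1$, $1\le t\le m$, $\mathcal{D}(s,t)$ (in the table with $m$ rows; here $m=5$) is the number of sequences $(r_1,\dots,r_s)$ with $r_i\in\{1,\dots,m\}$, $|r_{i+1}-r_i|\le1$ and $r_s=t$, i.e. the number of lattice paths with steps $(1,0),(1,1),(1,-1)$ from any cell of the first column to the cell in column $s$, row $t$, staying inside the table (this does not depend on the number of columns as long as it is at least $s$). $\mathcal{I}_m(n)$ is the number of sequences $(r_1,\dots,r_n)$ with $r_i\in\{1,\dots,m\}$ and $|r_{i+1}-r_i|\le1$. -}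

module Defs where

open import Data.Nat using (ℕ; zero; suc; _≤_)
open import Data.Nat.Properties using (_≤?_)
open import Data.Fin using (Fin; toℕ)
open import Data.List using (List; []; _∷_; map; concatMap; filter; length)
open import Data.Vec using (Vec; []; _∷_)
open import Data.Product using (_×_; _,_)
open import Data.Unit using (⊤)
open import Data.List using (allFin)
open import Relation.Nullary using (Dec; yes; no)
open import Relation.Nullary.Decidable using (_×-dec_)
open import Relation.Binary.PropositionalEquality using (_≡_)
import Data.Fin as F

-- rows are Fin m; row r (1-based in the paper) is the element with toℕ = r - 1.
-- |a - b| ≤ 1 for rows a b
Close : {m : ℕ} → Fin m → Fin m → Set
Close a b = (toℕ a ≤ suc (toℕ b)) × (toℕ b ≤ suc (toℕ a))

close? : {m : ℕ} (a b : Fin m) → Dec (Close a b)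
close? a b = (toℕ a ≤? suc (toℕ b)) ×-dec (toℕ b ≤? suc (toℕ a))

data Admissible {m : ℕ} : {n : ℕ} → Vec (Fin m) n → Set where
  adm-nil  : Admissible []
  adm-one  : (a : Fin m) → Admissible (a ∷ [])
  adm-cons : {n : ℕ} (a b : Fin m) (v : Vec (Fin m) n) →
             Close a b → Admissible (b ∷ v) → Admissible (a ∷ b ∷ v)

admissible? : {m n : ℕ} (v : Vec (Fin m) n) → Dec (Admissible v)
admissible? [] = yes adm-nil
admissible? (a ∷ []) = yes (adm-one a)
admissible? (a ∷ b ∷ v) with close? a b | admissible? (b ∷ v)
... | yes p | yes q = yes (adm-cons a b v p q)
... | no ¬p | _ = no λ { (adm-cons _ _ _ p _) → ¬p p }
... | yes _ | no ¬q = no λ { (adm-cons _ _ _ _ q) → ¬q q }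

allVecs : (m n : ℕ) → List (Vec (Fin m) n)
allVecs m zero = [] ∷ []
allVecs m (suc n) = concatMap (λ a → map (a ∷_) (allVecs m n)) (allFin m)

lastV : {A : Set} {n : ℕ} → Vec A (suc n) → A
lastV (a ∷ []) = a
lastV (a ∷ b ∷ v) = lastV (b ∷ v)

I : (m n : ℕ) → ℕ
I m n = length (filter admissible? (allVecs m n))

-- D(s,t) in the table with m rows: such sequences of length s with r_s = t
-- (t given as a row in Fin m, i.e. paper's t = toℕ t + 1)
D : (m s : ℕ) → Fin m → ℕ
D m zero t = 0
D m (suc s) t =
  length (filter (λ v → admissible? v ×-dec (lastV v F.≟ t)) (allVecs m (suc s)))

-- Let T be the transfer matrix of the relation |r - r'| ≤ 1 on the rows, 𝟙 the all-ones vector and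
-- e_t the t-th unit vector. Splitting a sequence after its first entry and using that T is symmetric
-- gives D(k + n + 1, t) = ⟨Tᵏ𝟙, Tⁿe_t⟩ and I(k + 1) = ⟨𝟙, Tᵏ𝟙⟩. With five rows, Tᵏ𝟙 always has the
-- shape (a, b, c, b, a) with c + 1 = 2a, and T²e₁ = (2, 2, 1, 0, 0), T²e₃ = (1, 2, 3, 2, 1). Hence
-- D(s + 2, 1) = 2a + 2b + c = I(s) and D(s + 2, 3) = 2a + 4b + 3c = 2 I(s) - 1.
module Submission where

open import Data.Bool.Base using (true; false; if_then_else_)
open import Data.Fin using (Fin; zero; suc; _≟_; #_)
open import Data.List.Base using (List; []; _∷_; _++_; map; concatMap; filter; length; tabulate)
open import Data.List.Properties using (length-++; filter-++; filter-≐; filter-none)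
import Data.List.Relation.Unary.All as All
open import Data.Nat.Base using (ℕ; zero; suc; _+_; _*_; _∸_; _≥_)
open import Data.Nat.GeneralisedArithmetic using (fold; fold-+; iterate-is-fold)
open import Data.Nat.Properties using (+-*-semiring; *-identityˡ; *-assoc; *-comm; m+n∸n≡m)
open import Algebra.Properties.Semiring.Sum +-*-semiring
  using (sum; sum-syntax; ∑-comm; *-distribˡ-sum; *-distribʳ-sum; sum-cong-≗)
open import Data.Nat.Tactic.RingSolver using (solve-∀)
open import Data.Product.Base using (_×_; _,_; proj₁; swap; map₁)
open import Data.Unit.Base using (tt)
open import Data.Vec.Base using (Vec; []; _∷_; lookup)
open import Data.Vec.Functional using (Vector)
open import Data.Vec.Properties using (lookup-replicate)
open import Function.Base using (_∘_; id)
open import Function.Bundles using (mk⇔)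
open import Relation.Nullary.Decidable using (yes; no; does; _×-dec_; does-⇔; dec-true; dec-false)
open import Relation.Nullary.Negation using (¬_)
open import Relation.Unary using (Decidable)
open import Relation.Binary.PropositionalEquality
  using (_≡_; _≗_; refl; sym; trans; cong; module ≡-Reasoning)

open import Defs

private variable
  m n : ℕ
  A B : Set

length-filter-map : {P : A → Set} (P? : Decidable P) (f : B → A) (xs : List B) →
  length (filter P? (map f xs)) ≡ length (filter (P? ∘ f) xs)
length-filter-map P? f [] = refl
length-filter-map P? f (x ∷ xs) with does (P? (f x))
... | true  = cong suc (length-filter-map P? f xs)
... | false = length-filter-map P? f xs

length-filter-concatMap-tabulate : {P : A → Set} (P? : Decidable P) (f : B → List A) (g : Fin m → B) →
  length (filter P? (concatMap f (tabulate g))) ≡ ∑[ i < m ] length (filter P? (f (g i)))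
length-filter-concatMap-tabulate {m = zero}  P? f g = refl
length-filter-concatMap-tabulate {m = suc m} P? f g = begin
  length (filter P? (f (g zero) ++ concatMap f (tabulate (g ∘ suc))))
    ≡⟨ cong length (filter-++ P? (f (g zero)) _) ⟩
  length (filter P? (f (g zero)) ++ filter P? (concatMap f (tabulate (g ∘ suc))))
    ≡⟨ length-++ (filter P? (f (g zero))) ⟩
  length (filter P? (f (g zero))) + length (filter P? (concatMap f (tabulate (g ∘ suc))))
    ≡⟨ cong (length (filter P? (f (g zero))) +_) (length-filter-concatMap-tabulate P? f (g ∘ suc)) ⟩
  ∑[ i < suc m ] length (filter P? (f (g i)))
    ∎
  where open ≡-Reasoning

length-filter-allVecs-suc : {P : Vec (Fin m) (suc n) → Set} (P? : Decidable P) →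
  length (filter P? (allVecs m (suc n))) ≡ ∑[ a < m ] length (filter (P? ∘ (a ∷_)) (allVecs m n))
length-filter-allVecs-suc {m} {n} P? = trans
  (length-filter-concatMap-tabulate P? (λ a → map (a ∷_) (allVecs m n)) id)
  (sum-cong-≗ λ a → length-filter-map P? (a ∷_) (allVecs m n))

admissible-close : {a b : Fin m} {v : Vec (Fin m) n} → Admissible (a ∷ b ∷ v) → Close a b
admissible-close (adm-cons _ _ _ a∼b _) = a∼b

admissible-tail : {a b : Fin m} {v : Vec (Fin m) n} → Admissible (a ∷ b ∷ v) → Admissible (b ∷ v)
admissible-tail (adm-cons _ _ _ _ adm) = adm

adjacency : Fin m → Fin m → ℕ
adjacency a b = if does (close? a b) then 1 else 0

adjacency-close : {a b : Fin m} → Close a b → adjacency a b ≡ 1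
adjacency-close {a = a} {b} a∼b = cong (if_then 1 else 0) (dec-true (close? a b) a∼b)

adjacency-¬close : {a b : Fin m} → ¬ Close a b → adjacency a b ≡ 0
adjacency-¬close {a = a} {b} a≁b = cong (if_then 1 else 0) (dec-false (close? a b) a≁b)

adjacency-sym : (a b : Fin m) → adjacency a b ≡ adjacency b a
adjacency-sym a b = cong (if_then 1 else 0) (does-⇔ (mk⇔ swap swap) (close? a b) (close? b a))

transfer : Vector ℕ m → Vector ℕ m
transfer {m} w a = ∑[ b < m ] (adjacency a b * w b)

transfer-cong : {u v : Vector ℕ m} → u ≗ v → transfer u ≗ transfer v
transfer-cong u≗v a = sum-cong-≗ λ b → cong (adjacency a b *_) (u≗v b)

transfer-fold : (u : Vector ℕ m) (n : ℕ) → transfer (fold u transfer n) ≡ fold (transfer u) transfer n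
transfer-fold u n = trans (iterate-is-fold u transfer (suc n)) (sym (iterate-is-fold (transfer u) transfer n))

indicator : {P : Fin m → Set} → Decidable P → Vector ℕ m
indicator P? t = if does (P? t) then 1 else 0

walksFrom : {P : Fin m → Set} → Decidable P → ℕ → Vector ℕ m
walksFrom {m} P? n a = length (filter (λ v → admissible? (a ∷ v) ×-dec P? (lastV (a ∷ v))) (allVecs m n))

length-filter-admissible-∷ : {Q : Vec (Fin m) n → Set} (Q? : Decidable Q) (a b : Fin m) (xs : List (Vec (Fin m) n)) →
  length (filter (λ v → admissible? (a ∷ b ∷ v) ×-dec Q? v) xs)
    ≡ adjacency a b * length (filter (λ v → admissible? (b ∷ v) ×-dec Q? v) xs)
length-filter-admissible-∷ Q? a b xs with close? a b
... | yes a∼b = trans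
  (cong length (filter-≐ _ _ (map₁ admissible-tail , map₁ (adm-cons a b _ a∼b)) xs))
  (sym (trans (cong (_* _) (adjacency-close a∼b)) (*-identityˡ _)))
... | no a≁b = trans
  (cong length (filter-none _ (All.universal (λ _ → a≁b ∘ admissible-close ∘ proj₁) xs)))
  (cong (_* _) (sym (adjacency-¬close a≁b)))

walksFrom-zero : {P : Fin m → Set} (P? : Decidable P) → walksFrom P? 0 ≗ indicator P?
walksFrom-zero P? a with P? a
... | yes _ = refl
... | no _  = refl

walksFrom-suc : {P : Fin m → Set} (P? : Decidable P) (n : ℕ) → walksFrom P? (suc n) ≗ transfer (walksFrom P? n)
walksFrom-suc {m} P? n a = trans (length-filter-allVecs-suc {m} {n} _)
  (sum-cong-≗ λ b → length-filter-admissible-∷ (λ v → P? (lastV (b ∷ v))) a b (allVecs m n))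

walksFrom≗fold : {P : Fin m → Set} (P? : Decidable P) (n : ℕ) → walksFrom P? n ≗ fold (indicator P?) transfer n
walksFrom≗fold P? zero      = walksFrom-zero P?
walksFrom≗fold P? (suc n) a = trans (walksFrom-suc P? n a) (transfer-cong (walksFrom≗fold P? n) a)

D≡∑walksFrom : (t : Fin m) → D m (suc n) t ≡ ∑[ a < m ] walksFrom (_≟ t) n a
D≡∑walksFrom {m} {n} t = length-filter-allVecs-suc {m} {n} _

I≡∑walksFrom : I m (suc n) ≡ ∑[ a < m ] walksFrom (λ _ → yes tt) n a
I≡∑walksFrom {m} {n} = trans
  (cong length (filter-≐ admissible? (λ v → admissible? v ×-dec yes tt) ((_, tt) , proj₁) (allVecs m (suc n))))
  (length-filter-allVecs-suc {m} {n} _)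

infix 7 _·_
_·_ : Vector ℕ m → Vector ℕ m → ℕ
_·_ {m} u v = ∑[ i < m ] (u i * v i)

𝟙 : Vector ℕ m
𝟙 _ = 1

sum≡𝟙· : (v : Vector ℕ m) → sum v ≡ 𝟙 · v
sum≡𝟙· v = sum-cong-≗ λ i → sym (*-identityˡ (v i))

·-congˡ : {u u′ : Vector ℕ m} → u ≗ u′ → (v : Vector ℕ m) → u · v ≡ u′ · v
·-congˡ u≗u′ v = sum-cong-≗ λ i → cong (_* v i) (u≗u′ i)

·-comm : (u v : Vector ℕ m) → u · v ≡ v · u
·-comm u v = sum-cong-≗ λ i → *-comm (u i) (v i)

transfer-selfAdjoint : (u v : Vector ℕ m) → u · transfer v ≡ transfer u · v
transfer-selfAdjoint {m} u v = begin
  ∑[ a < m ] (u a * ∑[ b < m ] (adjacency a b * v b))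
    ≡⟨ sum-cong-≗ (λ a → *-distribˡ-sum (u a) (λ b → adjacency a b * v b)) ⟩
  ∑[ a < m ] ∑[ b < m ] (u a * (adjacency a b * v b))
    ≡⟨ ∑-comm (λ a b → u a * (adjacency a b * v b)) ⟩
  ∑[ b < m ] ∑[ a < m ] (u a * (adjacency a b * v b))
    ≡⟨ sum-cong-≗ (λ b → sum-cong-≗ λ a → exchange (u a) (adjacency-sym a b) (v b)) ⟩
  ∑[ b < m ] ∑[ a < m ] (adjacency b a * u a * v b)
    ≡⟨ sum-cong-≗ (λ b → *-distribʳ-sum (v b) (λ a → adjacency b a * u a)) ⟨
  ∑[ b < m ] (∑[ a < m ] (adjacency b a * u a) * v b)
    ∎
  where
  open ≡-Reasoning
  exchange : ∀ x {y y′} → y ≡ y′ → ∀ z → x * (y * z) ≡ y′ * x * z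
  exchange x {y} refl z = trans (sym (*-assoc x y z)) (cong (_* z) (*-comm x y))

fold-transfer-selfAdjoint : (u v : Vector ℕ m) (n : ℕ) → u · fold v transfer n ≡ fold u transfer n · v
fold-transfer-selfAdjoint u v zero    = refl
fold-transfer-selfAdjoint u v (suc n) = begin
  u · transfer (fold v transfer n)  ≡⟨ transfer-selfAdjoint u _ ⟩
  transfer u · fold v transfer n    ≡⟨ fold-transfer-selfAdjoint (transfer u) v n ⟩
  fold (transfer u) transfer n · v  ≡⟨ cong (_· v) (transfer-fold u n) ⟨
  transfer (fold u transfer n) · v  ∎
  where open ≡-Reasoning

sum-walksFrom : {P : Fin m → Set} (P? : Decidable P) (k n : ℕ) →
  ∑[ a < m ] walksFrom P? (k + n) a ≡ fold 𝟙 transfer k · fold (indicator P?) transfer n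
sum-walksFrom P? k n = begin
  ∑[ a < _ ] walksFrom P? (k + n) a                     ≡⟨ sum-cong-≗ (walksFrom≗fold P? (k + n)) ⟩
  sum (fold (indicator P?) transfer (k + n))            ≡⟨ sum≡𝟙· (fold (indicator P?) transfer (k + n)) ⟩
  𝟙 · fold (indicator P?) transfer (k + n)              ≡⟨ cong (𝟙 ·_) (fold-+ (indicator P?) transfer k) ⟩
  𝟙 · fold (fold (indicator P?) transfer n) transfer k  ≡⟨ fold-transfer-selfAdjoint 𝟙 (fold (indicator P?) transfer n) k ⟩
  fold 𝟙 transfer k · fold (indicator P?) transfer n    ∎
  where open ≡-Reasoning

D≡· : (k n : ℕ) (t : Fin m) → D m (suc (k + n)) t ≡ fold 𝟙 transfer k · fold (indicator (_≟ t)) transfer n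
D≡· k n t = trans (D≡∑walksFrom {n = k + n} t) (sum-walksFrom (_≟ t) k n)

I≡· : (k : ℕ) → I m (suc k) ≡ 𝟙 · fold (𝟙 {m}) transfer k
I≡· {m} k = trans (I≡∑walksFrom {m} {k}) (sum-walksFrom {m} (λ _ → yes tt) 0 k)

profile : ℕ → ℕ → ℕ → Vector ℕ 5
profile a b c = lookup (a ∷ b ∷ c ∷ b ∷ a ∷ [])

record Balanced (u : Vector ℕ 5) : Set where
  constructor balanced
  field
    a b c  : ℕ
    shape  : u ≗ profile a b c
    middle : c + 1 ≡ a + a

transfer-profile : (a b c : ℕ) → transfer (profile a b c) ≗ profile (a + b) (a + b + c) (b + c + b)
transfer-profile a b c = λ where
    zero                         → pair a b
    (suc zero)                   → triple a b c
    (suc (suc zero))             → triple b c b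
    (suc (suc (suc zero)))       → triple-reversed c b a
    (suc (suc (suc (suc zero)))) → pair-reversed b a
  where
  pair : ∀ x y → x + 0 + (y + 0 + 0) ≡ x + y
  pair = solve-∀
  pair-reversed : ∀ x y → x + 0 + (y + 0 + 0) ≡ y + x
  pair-reversed = solve-∀
  triple : ∀ x y z → x + 0 + (y + 0 + (z + 0 + 0)) ≡ x + y + z
  triple = solve-∀
  triple-reversed : ∀ x y z → x + 0 + (y + 0 + (z + 0 + 0)) ≡ z + y + x
  triple-reversed = solve-∀

balanced-𝟙 : Balanced 𝟙
balanced-𝟙 = balanced 1 1 1 (λ i → sym (lookup-replicate i 1)) refl

balanced-transfer : {u : Vector ℕ 5} → Balanced u → Balanced (transfer u)
balanced-transfer (balanced a b c shape middle) = balanced (a + b) (a + b + c) (b + c + b)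
  (λ i → trans (transfer-cong shape i) (transfer-profile a b c i))
  (begin
    b + c + b + 1    ≡⟨ regroup b c ⟩
    b + b + (c + 1)  ≡⟨ cong (b + b +_) middle ⟩
    b + b + (a + a)  ≡⟨ interleave a b ⟩
    a + b + (a + b)  ∎)
  where
  open ≡-Reasoning
  regroup : ∀ b c → b + c + b + 1 ≡ b + b + (c + 1)
  regroup = solve-∀
  interleave : ∀ a b → b + b + (a + a) ≡ a + b + (a + b)
  interleave = solve-∀

balanced-fold : (k : ℕ) → Balanced (fold 𝟙 transfer k)
balanced-fold zero    = balanced-𝟙
balanced-fold (suc k) = balanced-transfer (balanced-fold k)

balanced-· : {u : Vector ℕ 5} (β : Balanced u) (w : Vector ℕ 5) → let open Balanced β in
  u · w ≡ a * (w (# 0) + w (# 4)) + b * (w (# 1) + w (# 3)) + c * w (# 2)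
balanced-· (balanced a b c shape _) w = trans (·-congˡ shape w) (fold-ends a b c (w _) (w _) (w _) (w _) (w _))
  where
  fold-ends : ∀ a b c p q r s t → a * p + (b * q + (c * r + (b * s + (a * t + 0)))) ≡ a * (p + t) + b * (q + s) + c * r
  fold-ends = solve-∀

first-row : {u : Vector ℕ 5} → Balanced u → u · fold (indicator (_≟ # 0)) transfer 2 ≡ u · 𝟙
first-row β = trans (balanced-· β (fold (indicator (_≟ # 0)) transfer 2)) (sym (balanced-· β 𝟙))

third-row : {u : Vector ℕ 5} → Balanced u → u · fold (indicator (_≟ # 2)) transfer 2 + 1 ≡ 2 * (u · 𝟙)
third-row {u} β@(balanced a b c _ middle) = begin
  u · fold (indicator (_≟ # 2)) transfer 2 + 1
    ≡⟨ cong (_+ 1) (balanced-· β (fold (indicator (_≟ # 2)) transfer 2)) ⟩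
  a * 2 + b * 4 + c * 3 + 1      ≡⟨ regroup a b c ⟩
  2 * (a + b * 2 + c) + (c + 1)  ≡⟨ cong (2 * (a + b * 2 + c) +_) middle ⟩
  2 * (a + b * 2 + c) + (a + a)  ≡⟨ collect a b c ⟩
  2 * (a * 2 + b * 2 + c * 1)    ≡⟨ cong (2 *_) (balanced-· β 𝟙) ⟨
  2 * (u · 𝟙)                    ∎
  where
  open ≡-Reasoning
  regroup : ∀ a b c → a * 2 + b * 4 + c * 3 + 1 ≡ 2 * (a + b * 2 + c) + (c + 1)
  regroup = solve-∀
  collect : ∀ a b c → 2 * (a + b * 2 + c) + (a + a) ≡ 2 * (a * 2 + b * 2 + c * 1)
  collect = solve-∀

proposition4p1 : (s : ℕ) → s ≥ 1 →
    (D 5 (s + 2) zero ≡ I 5 s) × (D 5 (s + 2) (suc (suc zero)) ≡ 2 * I 5 s ∸ 1)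
proposition4p1 (suc k) _ = first , third
  where
  open ≡-Reasoning
  u : Vector ℕ 5
  u = fold 𝟙 transfer k
  I≡u·𝟙 : I 5 (suc k) ≡ u · 𝟙
  I≡u·𝟙 = trans (I≡· k) (·-comm 𝟙 u)
  first : D 5 (suc k + 2) zero ≡ I 5 (suc k)
  first = begin
    D 5 (suc k + 2) (# 0)                      ≡⟨ D≡· k 2 (# 0) ⟩
    u · fold (indicator (_≟ # 0)) transfer 2   ≡⟨ first-row (balanced-fold k) ⟩
    u · 𝟙                                      ≡⟨ I≡u·𝟙 ⟨
    I 5 (suc k)                                ∎
  third+1 : D 5 (suc k + 2) (suc (suc zero)) + 1 ≡ 2 * I 5 (suc k)
  third+1 = begin
    D 5 (suc k + 2) (# 2) + 1                     ≡⟨ cong (_+ 1) (D≡· k 2 (# 2)) ⟩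
    u · fold (indicator (_≟ # 2)) transfer 2 + 1  ≡⟨ third-row (balanced-fold k) ⟩
    2 * (u · 𝟙)                                   ≡⟨ cong (2 *_) I≡u·𝟙 ⟨
    2 * I 5 (suc k)                               ∎
  third : D 5 (suc k + 2) (suc (suc zero)) ≡ 2 * I 5 (suc k) ∸ 1
  third = trans (sym (m+n∸n≡m _ 1)) (cong (_∸ 1) third+1)
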